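{- Let $I=(G,v_0,c,d,Q)$ be an MWCARP instance with $(v_0,v_0)\in R_d$, such that $G[R_d]$ has $C$ weakly connected components, and let $(\mathcal W^*,s^*)$ be an optimal solution. Let $T$ be a closed walk in $G$ starting and ending at $v_0$ that is a $\beta(C)$-approximate solution of the MWRPP instance $(G,c,R_d)$ (i.e., it traverses all elements of $R_d$ and its cost is at most $\beta(C)$ times the optimum of that instance), and let $(\mathcal W,s)$ be a feasible splitting of $T$. Then $c(\mathcal W)\le c(T)\le \beta(C)\,c(\mathcal W^*)$.
   Context: Mixed graph $G=(V,E,A)$ (undirected edges $E$, arcs $A\subseteq V\times V$, loops allowed), windy travel costs $c\colon V\times V\to\mathbb N\cup\{0,\infty\}$. Walks: sequences of pairs $(u,v)$ with $(u,v)\in A$ or $\{u,v\}\in E$ and matching consecutive head/tail; closed if returning to the start; cost is the sum of costs; cost of a set/tuple of walks is the sum. MWCARP: given $G$, depot $v_0$, $c$, demands $d\colon E\cup A\to\mathbb N\cup\{0\}$, capacity $Q$, find closed walks $\mathcal W$ each through $v_0$ and a serving function $s\colon\mathcal W\to 2^{E\cup A}$ with $\sum_{e\in s(w)}d(e)\le Q$ and each positive-demand element served by exactly one walk, minimizing $c(\mathcal W)$. $R_d=\{a\in E\cup A: d(a)>0\}$. MWRPP $(G,c,R)$: find a minimum-cost closed walk traversing all of $R$. A segment of a walk $(a_1,\dots,a_m)$ is a consecutive subsequence; segments $(a_i,\dots,a_j)$ and $(a_{i'},\dots,a_{j'})$ are non-overlapping if $j<i'$ or $j'<i$. For a closed walk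 $T$ containing all of $R_d$, a feasible splitting of $T$ is a pair $(\mathcal W,s)$ where $\mathcal W=(w_1,\dots,w_\ell)$ is a tuple of segments of $T$ and $s\colon\mathcal W\to 2^{R_d}$, such that: (i) the $w_i$ are mutually non-overlapping; (ii) concatenating $w_1,\dots,w_\ell$ in order gives a subsequence of $T$; (iii) each $w_i$ begins and ends with an element of $s(w_i)$; (iv) $\{s(w_i)\}$ is a partition of $R_d$; (v) $\sum_{e\in s(w_i)}d(e)\le Q$ for all $i$, and for $i<\ell$, $\sum_{e\in s(w_i)}d(e)+d(a)>Q$ where $a$ is the first element served by $w_{i+1}$.
   Formalization: The approximation factor $\beta(C)$ takes nonnegative rational values. -}

module Defs where

open import Data.Nat using (ℕ; zero; suc; _+_; _*_; _∸_; _≤_; _<_)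
open import Data.Fin using (Fin; toℕ)
open import Data.Bool using (Bool; true; false; if_then_else_)
open import Data.Product using (Σ; ∃; ∃-syntax; _×_; _,_; proj₁; proj₂)
open import Data.Sum using (_⊎_; inj₁; inj₂)
open import Data.Maybe using (Maybe; just; nothing)
open import Data.List using (List; []; _∷_; head; last; length; take; drop; foldr)
open import Data.List.Relation.Unary.All using (All)
open import Data.List.Relation.Unary.Any using (Any)
open import Data.List.Relation.Unary.Linked using (Linked)
open import Data.Integer using (∣_∣)
open import Data.Rational using (ℚ; ↥_; ↧ₙ_)
open import Relation.Binary.PropositionalEquality using (_≡_; _≢_)
open import Relation.Binary.Construct.Closure.ReflexiveTransitive using (Star)
open import Function.Definitions using (Injective)

data ℕ∞ : Set where
  fin : ℕ → ℕ∞
  ∞   : ℕ∞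

infixl 6 _+∞_
_+∞_ : ℕ∞ → ℕ∞ → ℕ∞
fin a +∞ fin b = fin (a + b)
fin _ +∞ ∞     = ∞
∞     +∞ _     = ∞

infix 4 _≤∞_
data _≤∞_ : ℕ∞ → ℕ∞ → Set where
  fin≤fin : ∀ {a b} → a ≤ b → fin a ≤∞ fin b
  _≤∞∞    : ∀ x → x ≤∞ ∞

-- scalar multiplication by a natural number (convention 0 · ∞ = 0)
infixl 7 _·∞_
_·∞_ : ℕ → ℕ∞ → ℕ∞
k     ·∞ fin a = fin (k * a)
zero  ·∞ ∞     = fin 0
suc _ ·∞ ∞     = ∞

-- x ≤ b · y for a (nonnegative) rational b = p / q, i.e. q · x ≤ p · y
infix 4 _≤[_]·_
_≤[_]·_ : ℕ∞ → ℚ → ℕ∞ → Set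
x ≤[ b ]· y = (↧ₙ b) ·∞ x ≤∞ ∣ ↥ b ∣ ·∞ y

sumFin∞ : (ℓ : ℕ) → (Fin ℓ → ℕ∞) → ℕ∞
sumFin∞ zero    f = fin 0
sumFin∞ (suc ℓ) f = f Fin.zero +∞ sumFin∞ ℓ (λ i → f (Fin.suc i))

sumFin : (ℓ : ℕ) → (Fin ℓ → ℕ) → ℕ
sumFin zero    f = 0
sumFin (suc ℓ) f = f Fin.zero + sumFin ℓ (λ i → f (Fin.suc i))

-- Mixed graphs G = (V, E, A), V = Fin n; edges and arcs given by their
-- endpoints (edge endpoints are an unordered pair, arcs ordered; loops allowed).
-- E and A are sets: distinct edges have distinct endpoint sets, distinct arcs
-- distinct endpoint pairs.

SameEdge : ∀ {n} → Fin n × Fin n → Fin n × Fin n → Set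
SameEdge (u , v) (u' , v') = (u ≡ u' × v ≡ v') ⊎ (u ≡ v' × v ≡ u')

record MixedGraph : Set where
  field
    n m k    : ℕ
    edgeEnds : Fin m → Fin n × Fin n
    arcEnds  : Fin k → Fin n × Fin n
    edgesDistinct : ∀ e e' → SameEdge (edgeEnds e) (edgeEnds e') → e ≡ e'
    arcsDistinct  : Injective _≡_ _≡_ arcEnds

module _ (G : MixedGraph) where
  open MixedGraph G

  V : Set
  V = Fin n

  El : Set
  El = Fin m ⊎ Fin k

  ends : El → V × V
  ends (inj₁ e) = edgeEnds e
  ends (inj₂ a) = arcEnds a

  Traverses : El → V × V → Set
  Traverses (inj₁ e) p = SameEdge (edgeEnds e) p
  Traverses (inj₂ a) p = arcEnds a ≡ p

  IsWalk : List (V × V) → Set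
  IsWalk w = All (λ p → ∃[ x ] Traverses x p) w
           × Linked (λ p q → proj₂ p ≡ proj₁ q) w

  IsClosedWalk : List (V × V) → Set
  IsClosedWalk w = IsWalk w
    × (∃[ p ] ∃[ q ] (head w ≡ just p × last w ≡ just q × proj₂ q ≡ proj₁ p))

  StartsEndsAt : V → List (V × V) → Set
  StartsEndsAt v₀ w =
    ∃[ p ] ∃[ q ] (head w ≡ just p × last w ≡ just q × proj₁ p ≡ v₀ × proj₂ q ≡ v₀)

  PassesThrough : V → List (V × V) → Set
  PassesThrough v₀ w = Any (λ p → proj₁ p ≡ v₀ ⊎ proj₂ p ≡ v₀) w

  TraversesEl : List (V × V) → El → Set
  TraversesEl w x = Any (Traverses x) w

  cost : (V → V → ℕ∞) → List (V × V) → ℕ∞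
  cost c = foldr (λ p acc → c (proj₁ p) (proj₂ p) +∞ acc) (fin 0)

  load : (El → ℕ) → (El → Bool) → ℕ
  load d s = sumFin m (λ e → if s (inj₁ e) then d (inj₁ e) else 0)
           + sumFin k (λ a → if s (inj₂ a) then d (inj₂ a) else 0)

  Rd : (El → ℕ) → El → Set
  Rd d x = 0 < d x

  record CARPSolution (v₀ : V) (d : El → ℕ) (Q : ℕ) : Set where
    field
      ℓ       : ℕ
      walk    : Fin ℓ → List (V × V)
      serve   : Fin ℓ → El → Bool
      walksDistinct : Injective _≡_ _≡_ walk
      closed  : ∀ i → IsClosedWalk (walk i)
      through : ∀ i → PassesThrough v₀ (walk i)
      servedTraversed : ∀ i x → serve i x ≡ true → TraversesEl (walk i) x
      capacity : ∀ i → load d (serve i) ≤ Q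
      servedOnce : ∀ x → Rd d x →
        ∃[ i ] (serve i x ≡ true × (∀ j → serve j x ≡ true → j ≡ i))

  solCost : ∀ {v₀ d Q} → (V → V → ℕ∞) → CARPSolution v₀ d Q → ℕ∞
  solCost c S = sumFin∞ ℓ (λ i → cost c (walk i))
    where open CARPSolution S

  IsOptimalCARP : ∀ {v₀ d Q} → (V → V → ℕ∞) → CARPSolution v₀ d Q → Set
  IsOptimalCARP {v₀} {d} {Q} c S =
    (S' : CARPSolution v₀ d Q) → solCost c S ≤∞ solCost c S'

  Covers : (El → Set) → List (V × V) → Set
  Covers R w = ∀ x → R x → TraversesEl w x

  IsApproxRPP : ℚ → (V → V → ℕ∞) → (El → Set) → List (V × V) → Set
  IsApproxRPP b c R T = IsClosedWalk T × Covers R T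
    × (∀ T' → IsClosedWalk T' → Covers R T' → cost c T ≤[ b ]· cost c T')

  IncidentTo : (El → Set) → V → Set
  IncidentTo R v = ∃[ x ] (R x × (proj₁ (ends x) ≡ v ⊎ proj₂ (ends x) ≡ v))

  AdjIn : (El → Set) → V → V → Set
  AdjIn R u v = ∃[ x ] (R x × SameEdge (ends x) (u , v))

  WConn : (El → Set) → V → V → Set
  WConn R = Star (AdjIn R)

  -- G[R] has exactly C weakly connected components: there is a labelling of
  -- the vertices of G[R] by Fin C, surjective on G[R], whose fibres are
  -- exactly the weakly connected classes.
  HasWeakComponents : (El → Set) → ℕ → Set
  HasWeakComponents R C = Σ (V → Fin C) λ f →
      (∀ u v → IncidentTo R u → IncidentTo R v →
         (f u ≡ f v → WConn R u v) × (WConn R u v → f u ≡ f v))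
    × (∀ (j : Fin C) → ∃[ v ] (IncidentTo R v × f v ≡ j))

  -- feasible splittings of a closed walk T; segment i = positions st i .. en i
  segment : List (V × V) → ℕ → ℕ → List (V × V)
  segment T s e = take (suc (e ∸ s)) (drop s T)

  record FeasibleSplitting (d : El → ℕ) (Q : ℕ) (T : List (V × V)) : Set where
    field
      ℓ     : ℕ
      st en : Fin ℓ → ℕ
      serve : Fin ℓ → El → Bool
      st≤en  : ∀ i → st i ≤ en i
      en<len : ∀ i → en i < length T
    seg : Fin ℓ → List (V × V)
    seg i = segment T (st i) (en i)
    field
      nonOverlapping : ∀ i j → i ≢ j → en i < st j ⊎ en j < st i
      inOrder : ∀ i j → toℕ i < toℕ j → en i < st j
      beginsServed : ∀ i → ∃[ p ] (head (seg i) ≡ just p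
                        × ∃[ x ] (serve i x ≡ true × Traverses x p))
      endsServed   : ∀ i → ∃[ q ] (last (seg i) ≡ just q
                        × ∃[ x ] (serve i x ≡ true × Traverses x q))
      servesRd   : ∀ i x → serve i x ≡ true → Rd d x
      servedOnce : ∀ x → Rd d x →
        ∃[ i ] (serve i x ≡ true × (∀ j → serve j x ≡ true → j ≡ i))
      capacity : ∀ i → load d (serve i) ≤ Q
      maximal  : ∀ i j → toℕ j ≡ suc (toℕ i) →
        ∃[ x ] (serve j x ≡ true
               × (∃[ p ] (head (seg j) ≡ just p × Traverses x p))
               × Q < load d (serve i) + d x)

  splitCost : ∀ {d Q T} → (V → V → ℕ∞) → FeasibleSplitting d Q T → ℕ∞
  splitCost c W = sumFin∞ ℓ (λ i → cost c (seg i))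
    where open FeasibleSplitting W

module Submission where

-- (1) The segments of a feasible splitting lie along T in order and without
--     overlap, so their costs add up to at most c(T).  This follows from the
--     decomposition  c(T from s) = c(segment s..e) + c(T from e+1)  together with
--     the fact that dropping a prefix of a walk cannot increase its cost.
-- (2) Each walk of the optimal solution 𝒲* is a closed walk through the depot v₀,
--     so it can be rotated (a permutation of its steps) to start and end at v₀.
--     Concatenating the rotated walks gives one closed walk that traverses every
--     served element, i.e. all of R_d, and costs exactly c(𝒲*).  It is nonempty
--     because R_d is.  Hence it is feasible for the MWRPP instance (G, c, R_d), and
--     the approximation guarantee of T compares c(T) with it.

open import Defs
open import Data.Nat using (ℕ; _<_)
open import Data.Product using (_×_; _,_; ∃-syntax)
open import Data.List using (List)
open import Data.Rational using (ℚ; 0ℚ; _≤_)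
open import Relation.Binary.PropositionalEquality using (_≡_)

import Data.Nat as ℕ
open import Data.Nat using (zero; suc; z≤n; _∸_)
open import Data.Nat.Properties using (+-comm; +-assoc; +-mono-≤; m≤n+m; +-suc; m+[n∸m]≡n)
import Data.Nat.Properties as ℕ
open import Data.Fin using (Fin; toℕ)
open import Data.Product using (proj₁; proj₂)
open import Data.Sum using (_⊎_; inj₁; inj₂)
open import Data.Maybe using (just)
open import Data.List using ([]; _∷_; _++_; take; drop; last; head; concat; tabulate)
open import Data.List.Properties using (take++drop≡id; drop-drop)
open import Data.List.Membership.Propositional using (find)
open import Data.List.Membership.Propositional.Properties using (∈-∃++)
open import Data.List.Relation.Unary.All using (All)
import Data.List.Relation.Unary.All.Properties as All
open import Data.List.Relation.Unary.Any using (Any; here; there)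
import Data.List.Relation.Unary.Any.Properties as Any
open import Data.List.Relation.Unary.Linked using (Linked; [-]; _∷_)
open import Data.List.Relation.Binary.Permutation.Propositional using (_↭_; ↭-sym)
  renaming (refl to ↭-refl; prep to ↭-prep; swap to ↭-swap; trans to ↭-trans)
open import Data.List.Relation.Binary.Permutation.Propositional.Properties
  using (All-resp-↭; Any-resp-↭)
  renaming (++-comm to ↭-++-comm)
open import Relation.Binary.Structures using (IsPreorder)
import Relation.Binary.Reasoning.Base.Double as PreorderReasoning
open import Relation.Binary.PropositionalEquality
  using (refl; sym; trans; cong; cong₂; subst; isEquivalence; module ≡-Reasoning)

≤∞-reflexive : ∀ {x y} → x ≡ y → x ≤∞ y
≤∞-reflexive {fin a} refl = fin≤fin ℕ.≤-refl
≤∞-reflexive {∞}     refl = ∞ ≤∞∞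

≤∞-trans : ∀ {x y z} → x ≤∞ y → y ≤∞ z → x ≤∞ z
≤∞-trans (fin≤fin p) (fin≤fin q) = fin≤fin (ℕ.≤-trans p q)
≤∞-trans _           (_ ≤∞∞)     = _ ≤∞∞

≤∞-isPreorder : IsPreorder _≡_ _≤∞_
≤∞-isPreorder = record
  { isEquivalence = isEquivalence ; reflexive = ≤∞-reflexive ; trans = ≤∞-trans }

module ≤∞-Reasoning = PreorderReasoning ≤∞-isPreorder

0≤∞ : ∀ x → fin 0 ≤∞ x
0≤∞ (fin a) = fin≤fin z≤n
0≤∞ ∞       = fin 0 ≤∞∞

≤∞-+ˡ : ∀ x y → y ≤∞ x +∞ y
≤∞-+ˡ (fin a) (fin b) = fin≤fin (m≤n+m b a)
≤∞-+ˡ (fin a) ∞       = ∞ ≤∞∞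
≤∞-+ˡ ∞       y       = y ≤∞∞

+∞-mono : ∀ {x x' y y'} → x ≤∞ x' → y ≤∞ y' → x +∞ y ≤∞ x' +∞ y'
+∞-mono (fin≤fin p) (fin≤fin q) = fin≤fin (+-mono-≤ p q)
+∞-mono (fin≤fin p) (_ ≤∞∞)     = _ ≤∞∞
+∞-mono (_ ≤∞∞)     _           = _ ≤∞∞

+∞-identityˡ : ∀ x → fin 0 +∞ x ≡ x
+∞-identityˡ (fin a) = refl
+∞-identityˡ ∞       = refl

+∞-assoc : ∀ x y z → (x +∞ y) +∞ z ≡ x +∞ (y +∞ z)
+∞-assoc (fin a) (fin b) (fin c) = cong fin (+-assoc a b c)
+∞-assoc (fin a) (fin b) ∞       = refl
+∞-assoc (fin a) ∞       z       = refl
+∞-assoc ∞       y       z       = refl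

+∞-comm : ∀ x y → x +∞ y ≡ y +∞ x
+∞-comm (fin a) (fin b) = cong fin (+-comm a b)
+∞-comm (fin a) ∞       = refl
+∞-comm ∞       (fin b) = refl
+∞-comm ∞       ∞       = refl

+∞-swapˡ : ∀ x y z → x +∞ (y +∞ z) ≡ y +∞ (x +∞ z)
+∞-swapˡ x y z = begin
  x +∞ (y +∞ z)  ≡⟨ sym (+∞-assoc x y z) ⟩
  (x +∞ y) +∞ z  ≡⟨ cong (_+∞ z) (+∞-comm x y) ⟩
  (y +∞ x) +∞ z  ≡⟨ +∞-assoc y x z ⟩
  y +∞ (x +∞ z)  ∎
  where open ≡-Reasoning

sumFin∞-cong : ∀ ℓ {f g : Fin ℓ → ℕ∞} → (∀ i → f i ≡ g i) → sumFin∞ ℓ f ≡ sumFin∞ ℓ g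
sumFin∞-cong zero    f≡g = refl
sumFin∞-cong (suc ℓ) f≡g = cong₂ _+∞_ (f≡g Fin.zero) (sumFin∞-cong ℓ (λ i → f≡g (Fin.suc i)))

module _ {X : Set} where

  Consecutive : X × X → X × X → Set
  Consecutive p q = proj₂ p ≡ proj₁ q

  EndsMeet : List (X × X) → Set
  EndsMeet w = ∃[ p ] ∃[ q ] (head w ≡ just p × last w ≡ just q × proj₂ q ≡ proj₁ p)

  Departs Touches : X → X × X → Set
  Departs a p = proj₁ p ≡ a
  Touches a p = proj₁ p ≡ a ⊎ proj₂ p ≡ a

  data Path : X → List (X × X) → X → Set where
    stop : ∀ {u} → Path u [] u
    step : ∀ {u v p w} → proj₁ p ≡ u → Path (proj₂ p) w v → Path u (p ∷ w) v

  path-++ : ∀ {u m v xs ys} → Path u xs m → Path m ys v → Path u (xs ++ ys) v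
  path-++ stop        π  = π
  path-++ (step e π₁) π₂ = step e (path-++ π₁ π₂)

  path-split : ∀ {u v} xs {ys} → Path u (xs ++ ys) v → ∃[ m ] (Path u xs m × Path m ys v)
  path-split []       π          = _ , stop , π
  path-split (x ∷ xs) (step e π) =
    let m , π₁ , π₂ = path-split xs π in m , step e π₁ , π₂

  linked→path : ∀ p w {q} → Linked Consecutive (p ∷ w) → last (p ∷ w) ≡ just q →
    Path (proj₁ p) (p ∷ w) (proj₂ q)
  linked→path p []       _       refl = step refl stop
  linked→path p (p' ∷ w) (e ∷ l) eq =
    step refl (subst (λ u → Path u _ _) (sym e) (linked→path p' w l eq))

  path→linked : ∀ {u v p w} → Path u (p ∷ w) v →
    Linked Consecutive (p ∷ w) × ∃[ q ] (last (p ∷ w) ≡ just q × proj₂ q ≡ v)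
  path→linked (step e stop)        = [-] , _ , refl , refl
  path→linked (step e (step e' π)) =
    let l , finish = path→linked (step e' π) in sym e' ∷ l , finish

  closed→loop : ∀ {w} → Linked Consecutive w → EndsMeet w → ∃[ u ] Path u w u
  closed→loop {p ∷ w} l (.p , q , refl , ends , q↦p) =
    proj₁ p , subst (Path _ _) q↦p (linked→path p w l ends)

  loop→closed : ∀ {u w} {P : X × X → Set} → Path u w u → Any P w →
    Linked Consecutive w × EndsMeet w
  loop→closed {w = p ∷ w} π@(step e _) _ =
    let l , q , ends , q↦u = path→linked π in l , p , q , refl , ends , trans q↦u (sym e)

  touched→departs : ∀ {u v w} a → Path u w v → Any (Touches a) w →
    Any (Departs a) w ⊎ v ≡ a
  touched→departs a (step e π)           (here (inj₁ p↦a)) = inj₁ (here p↦a)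
  touched→departs a (step e stop)        (here (inj₂ p↦a)) = inj₂ p↦a
  touched→departs a (step e (step e' π)) (here (inj₂ p↦a)) = inj₁ (there (here (trans e' p↦a)))
  touched→departs a (step e π)           (there t) with touched→departs a π t
  ... | inj₁ d   = inj₁ (there d)
  ... | inj₂ v≡a = inj₂ v≡a

  loop-departs : ∀ {u w} a → Path u w u → Any (Touches a) w → Any (Departs a) w
  loop-departs a π t with touched→departs a π t
  loop-departs a _          _ | inj₁ d   = d
  loop-departs a (step e _) _ | inj₂ u≡a = here (trans e u≡a)

  rotate : ∀ {u w} a → Path u w u → Any (Touches a) w → ∃[ r ] (r ↭ w × Path a r a)
  rotate a π t with find (loop-departs a π t)
  ... | p , p∈w , p↦a with ∈-∃++ p∈w
  ... | xs , ys , refl with path-split xs π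
  ... | _ , π₁ , π₂@(step e _) =
    (p ∷ ys) ++ xs , ↭-++-comm (p ∷ ys) xs ,
    subst (λ x → Path x _ x) (trans (sym e) p↦a) (path-++ π₂ π₁)

  loops-concat : ∀ {a ℓ} (f : Fin ℓ → List (X × X)) → (∀ i → Path a (f i) a) →
    Path a (concat (tabulate f)) a
  loops-concat {ℓ = zero}  f loops = stop
  loops-concat {ℓ = suc ℓ} f loops =
    path-++ (loops Fin.zero) (loops-concat (λ i → f (Fin.suc i)) (λ i → loops (Fin.suc i)))

module _ (G : MixedGraph) (c : V G → V G → ℕ∞) where

  cost-++ : ∀ xs ys → cost G c (xs ++ ys) ≡ cost G c xs +∞ cost G c ys
  cost-++ []       ys = sym (+∞-identityˡ (cost G c ys))
  cost-++ (p ∷ xs) ys = begin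
    c₁ +∞ cost G c (xs ++ ys)              ≡⟨ cong (c₁ +∞_) (cost-++ xs ys) ⟩
    c₁ +∞ (cost G c xs +∞ cost G c ys)     ≡⟨ sym (+∞-assoc c₁ _ _) ⟩
    (c₁ +∞ cost G c xs) +∞ cost G c ys     ∎
    where open ≡-Reasoning
          c₁ : ℕ∞
          c₁ = c (proj₁ p) (proj₂ p)

  cost-↭ : ∀ {xs ys} → xs ↭ ys → cost G c xs ≡ cost G c ys
  cost-↭ ↭-refl            = refl
  cost-↭ (↭-prep p σ)      = cong (c (proj₁ p) (proj₂ p) +∞_) (cost-↭ σ)
  cost-↭ (↭-swap p q σ)    =
    trans (cong (λ r → c (proj₁ p) (proj₂ p) +∞ (c (proj₁ q) (proj₂ q) +∞ r)) (cost-↭ σ))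
          (+∞-swapˡ _ _ _)
  cost-↭ (↭-trans σ τ)     = trans (cost-↭ σ) (cost-↭ τ)

  cost-concat : ∀ {ℓ} (f : Fin ℓ → List (V G × V G)) →
    cost G c (concat (tabulate f)) ≡ sumFin∞ ℓ (λ i → cost G c (f i))
  cost-concat {zero}  f = refl
  cost-concat {suc ℓ} f =
    trans (cost-++ (f Fin.zero) _) (cong (cost G c (f Fin.zero) +∞_) (cost-concat (λ i → f (Fin.suc i))))

  cost-drop : ∀ n T → cost G c (drop n T) ≤∞ cost G c T
  cost-drop zero    T       = ≤∞-reflexive refl
  cost-drop (suc n) []      = ≤∞-reflexive refl
  cost-drop (suc n) (p ∷ T) = ≤∞-trans (cost-drop n T) (≤∞-+ˡ _ _)

  cost-drop-antitone : ∀ {b n} T → b ℕ.≤ n → cost G c (drop n T) ≤∞ cost G c (drop b T)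
  cost-drop-antitone {zero}  {n}     T       _           = cost-drop n T
  cost-drop-antitone {suc b} {suc n} []      _           = ≤∞-reflexive refl
  cost-drop-antitone {suc b} {suc n} (p ∷ T) (ℕ.s≤s b≤n) = cost-drop-antitone T b≤n

  cost-drop-segment : ∀ T {s e} → s ℕ.≤ e →
    cost G c (drop s T) ≡ cost G c (segment G T s e) +∞ cost G c (drop (suc e) T)
  cost-drop-segment T {s} {e} s≤e = begin
    cost G c (drop s T)
      ≡⟨ cong (cost G c) (sym (take++drop≡id k (drop s T))) ⟩
    cost G c (take k (drop s T) ++ drop k (drop s T))
      ≡⟨ cost-++ (take k (drop s T)) _ ⟩
    cost G c (segment G T s e) +∞ cost G c (drop k (drop s T))
      ≡⟨ cong (λ r → cost G c (segment G T s e) +∞ cost G c r) (drop-drop s k T) ⟩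
    cost G c (segment G T s e) +∞ cost G c (drop (s ℕ.+ k) T)
      ≡⟨ cong (λ n → cost G c (segment G T s e) +∞ cost G c (drop n T)) s+k≡1+e ⟩
    cost G c (segment G T s e) +∞ cost G c (drop (suc e) T)  ∎
    where
      open ≡-Reasoning
      k : ℕ
      k = suc (e ∸ s)
      s+k≡1+e : s ℕ.+ k ≡ suc e
      s+k≡1+e = trans (+-suc s (e ∸ s)) (cong suc (m+[n∸m]≡n s≤e))

  orderedSegments-cost : ∀ T ℓ (st en : Fin ℓ → ℕ) →
    (∀ i → st i ℕ.≤ en i) → (∀ i j → toℕ i < toℕ j → en i < st j) →
    ∀ b → (∀ i → b ℕ.≤ st i) →
    sumFin∞ ℓ (λ i → cost G c (segment G T (st i) (en i))) ≤∞ cost G c (drop b T)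
  orderedSegments-cost T zero    st en _    _       b _    = 0≤∞ _
  orderedSegments-cost T (suc ℓ) st en st≤en inOrder b b≤st = begin
    cost G c (segment G T (st 0F) (en 0F)) +∞ sumFin∞ ℓ (λ i → cost G c (segment G T (st (1+ i)) (en (1+ i))))
      ≲⟨ +∞-mono (≤∞-reflexive refl) later ⟩
    cost G c (segment G T (st 0F) (en 0F)) +∞ cost G c (drop (suc (en 0F)) T)
      ≡⟨ sym (cost-drop-segment T (st≤en 0F)) ⟩
    cost G c (drop (st 0F) T)
      ≲⟨ cost-drop-antitone T (b≤st 0F) ⟩
    cost G c (drop b T)  ∎
    where
      open ≤∞-Reasoning
      0F : Fin (suc ℓ)
      0F = Fin.zero
      1+_ : Fin ℓ → Fin (suc ℓ)
      1+_ = Fin.suc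
      -- the remaining segments all start after the first one ends
      later : sumFin∞ ℓ (λ i → cost G c (segment G T (st (1+ i)) (en (1+ i))))
                ≤∞ cost G c (drop (suc (en 0F)) T)
      later = orderedSegments-cost T ℓ (λ i → st (1+ i)) (λ i → en (1+ i))
        (λ i → st≤en (1+ i)) (λ i j i<j → inOrder (1+ i) (1+ j) (ℕ.s≤s i<j))
        (suc (en 0F)) (λ i → inOrder 0F (1+ i) (ℕ.s≤s z≤n))

  splitCost≤cost : ∀ {d Q T} (W : FeasibleSplitting G d Q T) → splitCost G c W ≤∞ cost G c T
  splitCost≤cost {T = T} W =
    orderedSegments-cost T ℓ st en st≤en inOrder 0 (λ _ → z≤n)
    where open FeasibleSplitting W

  solutionTour : ∀ {v₀ d Q} (S : CARPSolution G v₀ d Q) → ∃[ x ] Rd G d x →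
    ∃[ T ] (IsClosedWalk G T × Covers G (Rd G d) T × cost G c T ≡ solCost G c S)
  solutionTour {v₀} {d} S (x₀ , x₀∈R) = tour , ((valid , proj₁ closedTour) , proj₂ closedTour) , covers , tour-cost
    where
      open CARPSolution S
      rotated : ∀ i → ∃[ r ] (r ↭ walk i × Path v₀ r v₀)
      rotated i =
        let _ , loop = closed→loop (proj₂ (proj₁ (closed i))) (proj₂ (closed i))
        in rotate v₀ loop (through i)
      r : Fin ℓ → List (V G × V G)
      r i = proj₁ (rotated i)
      r↭walk : ∀ i → r i ↭ walk i
      r↭walk i = proj₁ (proj₂ (rotated i))
      tour : List (V G × V G)
      tour = concat (tabulate r)
      covers : Covers G (Rd G d) tour
      covers x x∈R =
        let i , served , _ = servedOnce x x∈R
        in Any.concat⁺ (Any.tabulate⁺ i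
             (Any-resp-↭ (↭-sym (r↭walk i)) (servedTraversed i x served)))
      valid : All (λ p → ∃[ x ] Traverses G x p) tour
      valid = All.concat⁺ (All.tabulate⁺ (λ i →
                All-resp-↭ (↭-sym (r↭walk i)) (proj₁ (proj₁ (closed i)))))
      closedTour : Linked Consecutive tour × EndsMeet tour
      closedTour = loop→closed (loops-concat r (λ i → proj₂ (proj₂ (rotated i))))
                               (covers x₀ x₀∈R)
      tour-cost : cost G c tour ≡ solCost G c S
      tour-cost = trans (cost-concat r) (sumFin∞-cong ℓ (λ i → cost-↭ (r↭walk i)))

lemma4 : (β : ℕ → ℚ) (G : MixedGraph) (v₀ : V G) (c : V G → V G → ℕ∞)
    (d : El G → ℕ) (Q : ℕ) (C : ℕ)
    → (∃[ x ] (0 < d x × ends G x ≡ (v₀ , v₀)))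
    → HasWeakComponents G (Rd G d) C
    → 0ℚ ≤ β C
    → (S* : CARPSolution G v₀ d Q) → IsOptimalCARP G c S*
    → (T : List (V G × V G)) → StartsEndsAt G v₀ T
    → IsApproxRPP G (β C) c (Rd G d) T
    → (W : FeasibleSplitting G d Q T)
    → (splitCost G c W ≤∞ cost G c T) × (cost G c T ≤[ β C ]· solCost G c S*)
lemma4 β G v₀ c d Q C (x₀ , x₀∈R , _) _ _ S* _ T _ (_ , _ , approx) W =
  let tour , closed , covers , tour-cost = solutionTour G c S* (x₀ , x₀∈R)
  in splitCost≤cost G c W , subst (cost G c T ≤[ β C ]·_) tour-cost (approx tour closed covers)
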